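{- For every $A:\mathcal U$ there is an equivalence $\mathsf{isSemiDecidable}(A)\simeq\Big(\exists_{f:\mathbb N\to\mathcal L(\mathbb N)}\ \mathsf{isComputable}(f)\times\big(A=\operatorname{defined}(f(0))\big)\Big)$.
   Context: Type theory: Martin-Löf type theory with universe $\mathcal U$, function extensionality, proposition extensionality and propositional truncations; $\exists_{x:X}B(x):=\lVert\sum_{x:X}B(x)\rVert$. $\mathcal L(Y):=\sum_{P:\mathcal U}\operatorname{isProp}(P)\times(P\to Y)$, components $\operatorname{defined},\operatorname{value}$, $\eta(y)=(1,-,\lambda u.y)$. Recursive machine: a pair $m=(i,s)$ of unary primitive recursive functions, $s$ read as $\mathbb N\to\mathbb N+\mathbb N$ via $\mathrm{inl}(n)=2n$, $\mathrm{inr}(n)=2n+1$; $\operatorname{run}_k(m,x):=s'^k(\mathrm{inl}(i(x)))$ where $s'(\mathrm{inl}\,x)=s(x)$, $s'(\mathrm{inr}\,y)=\mathrm{inr}\,y$; $\operatorname{eval}(m)(x)$ has extent $\sum_y\lVert\sum_k\operatorname{run}_k(m,x)=\mathrm{inr}\,y\rVert$ and value the first projection. $\mathsf{isComputable}(f):=\lVert\sum_m f=\operatorname{eval}(m)\rVert$; a total $h:\mathbb N\to 2$ is computable if $\eta\circ h$ is. For $h:\mathbb N\to2$, $\langle h\rangle:=\sum_n(h_n=1)$. $\mathsf{SemiDecision}(P):=\sum_{h:\mathbb N\to 2}\operatorname{isProp}\langle h\rangle\times\mathsf{isComputable}(h)\times(P\simeq\langle h\rangle)$ and $\mathsf{isSemiDecidable}(P):=\lVert\mathsf{SemiDecision}(P)\rVert$.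 -}

module Defs where

open import Level using (Level; _⊔_; 0ℓ; Setω) renaming (suc to lsuc)
open import Data.Nat using (ℕ; zero; suc; _+_; _*_; _∸_; _≤_)
open import Data.Nat.Properties using (≤-total; m+[n∸m]≡n)
  renaming (≡-irrelevant to ℕ-irrelevant)
open import Data.Fin using (Fin)
open import Data.Vec using (Vec; []; _∷_; lookup)
open import Data.Bool using (Bool; true; false)
open import Data.Sum using (_⊎_; inj₁; inj₂; map)
open import Function.Properties.Inverse.HalfAdjointEquivalence using (_≃_)
open import Data.Product using (Σ; Σ-syntax; _×_; _,_; proj₁; proj₂)
open import Data.Unit using (⊤; tt)
open import Relation.Nullary using (yes; no)
open import Relation.Binary.PropositionalEquality
  using (_≡_; refl; sym; trans; cong; subst)

isProp : ∀ {ℓ} → Set ℓ → Set ℓ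
isProp P = (x y : P) → x ≡ y

PropExt : (ℓ : Level) → Set (lsuc ℓ)
PropExt ℓ = {P Q : Set ℓ} → isProp P → isProp Q → (P → Q) → (Q → P) → P ≡ Q

record PropTrunc : Setω where
  field
    ∥_∥       : ∀ {ℓ} → Set ℓ → Set ℓ
    ∥∥-isProp : ∀ {ℓ} {X : Set ℓ} → isProp ∥ X ∥
    ∣_∣       : ∀ {ℓ} {X : Set ℓ} → X → ∥ X ∥
    ∥∥-rec    : ∀ {ℓ ℓ'} {X : Set ℓ} {P : Set ℓ'} → isProp P → (X → P) → ∥ X ∥ → P

-- Binary 2 = Bool, with 1 = true

𝟚 : Set
𝟚 = Bool

data PR : ℕ → Set where
  zeroF : ∀ {n} → PR n
  succF : PR 1
  projF : ∀ {n} → Fin n → PR n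
  compF : ∀ {m n} → PR m → Vec (PR n) m → PR n
  recF  : ∀ {n} → PR n → PR (suc (suc n)) → PR (suc n)

mutual
  ⟦_⟧ : ∀ {n} → PR n → Vec ℕ n → ℕ
  ⟦ zeroF ⟧ xs = 0
  ⟦ succF ⟧ (x ∷ []) = suc x
  ⟦ projF i ⟧ xs = lookup xs i
  ⟦ compF f gs ⟧ xs = ⟦ f ⟧ (⟦ gs ⟧* xs)
  ⟦ recF g h ⟧ (zero ∷ xs) = ⟦ g ⟧ xs
  ⟦ recF g h ⟧ (suc k ∷ xs) = ⟦ h ⟧ (k ∷ ⟦ recF g h ⟧ (k ∷ xs) ∷ xs)

  ⟦_⟧* : ∀ {m n} → Vec (PR n) m → Vec ℕ n → Vec ℕ m
  ⟦ [] ⟧* xs = []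
  ⟦ g ∷ gs ⟧* xs = ⟦ g ⟧ xs ∷ ⟦ gs ⟧* xs

⟦_⟧₁ : PR 1 → ℕ → ℕ
⟦ f ⟧₁ x = ⟦ f ⟧ (x ∷ [])

-- decoding ℕ as ℕ + ℕ : inl(n) = 2n, inr(n) = 2n+1
decode : ℕ → ℕ ⊎ ℕ
decode zero = inj₁ 0
decode (suc zero) = inj₂ 0
decode (suc (suc n)) = map suc suc (decode n)

Machine : Set
Machine = PR 1 × PR 1

step : Machine → ℕ ⊎ ℕ → ℕ ⊎ ℕ
step (i , s) (inj₁ x) = decode (⟦ s ⟧₁ x)
step (i , s) (inj₂ y) = inj₂ y

iter : Machine → ℕ → ℕ ⊎ ℕ → ℕ ⊎ ℕ
iter m zero z = z
iter m (suc k) z = iter m k (step m z)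

run : ℕ → Machine → ℕ → ℕ ⊎ ℕ
run k m x = iter m k (inj₁ (⟦ proj₁ m ⟧₁ x))

iter-inj₂ : ∀ m j y → iter m j (inj₂ y) ≡ inj₂ y
iter-inj₂ m zero y = refl
iter-inj₂ m (suc j) y = iter-inj₂ m j y

iter-+ : ∀ m k j z → iter m (k + j) z ≡ iter m j (iter m k z)
iter-+ m zero j z = refl
iter-+ m (suc k) j z = iter-+ m k j (step m z)

run-det-≤ : ∀ m x k k' y y' → k ≤ k' → run k m x ≡ inj₂ y → run k' m x ≡ inj₂ y' → y ≡ y'
run-det-≤ m x k k' y y' le p q =
  inj₂-injective (trans (sym (iter-inj₂ m (k' ∸ k) y))
    (trans (cong (iter m (k' ∸ k)) (sym p))
    (trans (sym (iter-+ m k (k' ∸ k) _))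
    (trans (cong (λ t → iter m t (inj₁ (⟦ proj₁ m ⟧₁ x))) (m+[n∸m]≡n le)) q))))
  where inj₂-injective : ∀ {a b : ℕ} → _≡_ {A = ℕ ⊎ ℕ} (inj₂ a) (inj₂ b) → a ≡ b
        inj₂-injective refl = refl

run-det : ∀ m x k k' y y' → run k m x ≡ inj₂ y → run k' m x ≡ inj₂ y' → y ≡ y'
run-det m x k k' y y' p q with ≤-total k k'
... | inj₁ le = run-det-≤ m x k k' y y' le p q
... | inj₂ le = sym (run-det-≤ m x k' k y' y le q p)

module WithTrunc (pt : PropTrunc) where
  open PropTrunc pt public

  ∃-syntax' : ∀ {a b} (X : Set a) → (X → Set b) → Set (a ⊔ b)
  ∃-syntax' X B = ∥ Σ X B ∥

  syntax ∃-syntax' X (λ x → B) = ∃[ x ∈ X ] B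

  𝓛 : Set → Set₁
  𝓛 Y = Σ[ P ∈ Set ] (isProp P × (P → Y))

  defined : ∀ {Y} → 𝓛 Y → Set
  defined = proj₁

  value : ∀ {Y} (l : 𝓛 Y) → defined l → Y
  value l = proj₂ (proj₂ l)

  η : ∀ {Y} → Y → 𝓛 Y
  η y = ⊤ , (λ { tt tt → refl }) , (λ _ → y)

  Halts : Machine → ℕ → Set
  Halts m x = Σ[ y ∈ ℕ ] ∥ Σ[ k ∈ ℕ ] run k m x ≡ inj₂ y ∥

  Halts-isProp : ∀ m x → isProp (Halts m x)
  Halts-isProp m x (y , t) (y' , t') = go e t'
    where
    e : y ≡ y'
    e = ∥∥-rec (λ _ _ → ℕ-irrelevant _ _)
          (λ { (k , p) → ∥∥-rec (λ _ _ → ℕ-irrelevant _ _)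
                 (λ { (k' , q) → run-det m x k k' y y' p q }) t' }) t
    go : y ≡ y' → (t'' : ∥ Σ[ k ∈ ℕ ] run k m x ≡ inj₂ y' ∥) → (y , t) ≡ (y' , t'')
    go refl t'' = cong (y ,_) (∥∥-isProp t t'')

  eval : Machine → ℕ → 𝓛 ℕ
  eval m x = Halts m x , Halts-isProp m x , proj₁

  isComputable : (ℕ → 𝓛 ℕ) → Set₁
  isComputable f = ∥ Σ[ m ∈ Machine ] f ≡ eval m ∥

  𝟚→ℕ : 𝟚 → ℕ
  𝟚→ℕ false = 0
  𝟚→ℕ true = 1

  isComputable𝟚 : (ℕ → 𝟚) → Set₁
  isComputable𝟚 h = isComputable (λ n → η (𝟚→ℕ (h n)))

  ⟨_⟩ : (ℕ → 𝟚) → Set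
  ⟨ h ⟩ = Σ[ n ∈ ℕ ] h n ≡ true

  SemiDecision : Set → Set₁
  SemiDecision P = Σ[ h ∈ (ℕ → 𝟚) ] (isProp ⟨ h ⟩ × isComputable𝟚 h × (P ≃ ⟨ h ⟩))

  isSemiDecidable : Set → Set₁
  isSemiDecidable P = ∥ SemiDecision P ∥

-- Running a machine for k steps is primitive recursive in k and the input; both directions
-- rest on this. If A ≃ Σ n. h n = 1 for an h computed by a machine m, then A is equivalent to
-- the halting of the machine that counts c = 0, 1, 2, … and stops as soon as m, run for c
-- steps on some input below c, has returned 1: since a halted run stays halted, every n with
-- h n = 1 is eventually found this way. Conversely, if A is the halting of m on 0, then
-- "m halts at step n + 1 but not at step n" is a primitive recursive, hence computable,
-- predicate of n that holds for at most one n, and for some n exactly when m halts.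
module Submission where

open import Defs
open import Level using (0ℓ)
open import Data.Bool using (Bool; true; false; not; _∧_; _∨_; if_then_else_; _≟_)
open import Data.Bool.Properties using (∨-zeroʳ; T-≡)
open import Data.Empty using (⊥; ⊥-elim)
open import Data.Fin using (#_)
open import Data.Nat using (ℕ; zero; suc; _+_; _∸_; _≤_; _<_; _≡ᵇ_)
open import Data.Nat.Properties
  using (m+[n∸m]≡n; m≤m+n; +-suc; +-identityʳ; +-comm; <-cmp; ≡ᵇ⇒≡; ≡⇒≡ᵇ)
  renaming (≡-irrelevant to ℕ-irrelevant)
open import Data.Product using (Σ-syntax; _×_; _,_; proj₁; proj₂)
open import Data.Sum using (_⊎_; inj₁; inj₂; map; reduce)
open import Data.Unit using (tt)
open import Data.Vec using (Vec; []; _∷_)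
open import Function using (_∘_; Equivalence)
open import Function.Bundles using (mk↔ₛ′)
open import Function.Properties.Inverse.HalfAdjointEquivalence using (_≃_; ↔⇒≃)
open import Axiom.Extensionality.Propositional using (Extensionality)
open import Axiom.UniquenessOfIdentityProofs using (module Constant⇒UIP; module Decidable⇒UIP)
open import Relation.Binary.Definitions using (tri<; tri≈; tri>)
open import Relation.Binary.PropositionalEquality
open ≡-Reasoning

private variable
  n : ℕ

-- The 𝟚→ℕ of Defs, which is only in scope under a truncation structure.
bit : Bool → ℕ
bit b = if b then 1 else 0

infixr 9 _∘ᶜ_
_∘ᶜ_ : PR 1 → PR n → PR n
f ∘ᶜ g = compF f (g ∷ [])

constᶜ : ℕ → PR n
constᶜ zero = zeroF
constᶜ (suc k) = succF ∘ᶜ constᶜ k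

constᶜ-correct : ∀ k (xs : Vec ℕ n) → ⟦ constᶜ k ⟧ xs ≡ k
constᶜ-correct zero xs = refl
constᶜ-correct (suc k) xs = cong suc (constᶜ-correct k xs)

condᶜ : PR 3
condᶜ = recF (projF (# 1)) (projF (# 2))

andᶜ orᶜ : PR 2
andᶜ = recF zeroF (projF (# 2))
orᶜ = recF (projF (# 0)) (constᶜ 1)

notᶜ : PR 1
notᶜ = recF (constᶜ 1) zeroF

ifᶜ : PR n → PR n → PR n → PR n
ifᶜ b t e = compF condᶜ (b ∷ t ∷ e ∷ [])

_∧ᶜ_ _∨ᶜ_ : PR n → PR n → PR n
a ∧ᶜ b = compF andᶜ (a ∷ b ∷ [])
a ∨ᶜ b = compF orᶜ (a ∷ b ∷ [])

condᶜ-bit : ∀ {v x y} B → v ≡ bit B → ⟦ condᶜ ⟧ (v ∷ x ∷ y ∷ []) ≡ (if B then x else y)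
condᶜ-bit false refl = refl
condᶜ-bit true refl = refl

notᶜ-bit : ∀ {v} B → v ≡ bit B → ⟦ notᶜ ⟧₁ v ≡ bit (not B)
notᶜ-bit false refl = refl
notᶜ-bit true refl = refl

andᶜ-bit : ∀ {u v} A B → u ≡ bit A → v ≡ bit B → ⟦ andᶜ ⟧ (u ∷ v ∷ []) ≡ bit (A ∧ B)
andᶜ-bit false B refl refl = refl
andᶜ-bit true B refl refl = refl

orᶜ-bit : ∀ {u v} A B → u ≡ bit A → v ≡ bit B → ⟦ orᶜ ⟧ (u ∷ v ∷ []) ≡ bit (A ∨ B)
orᶜ-bit false B refl refl = refl
orᶜ-bit true B refl refl = refl

eqᶜ : ℕ → PR 1
eqᶜ zero = notᶜ
eqᶜ (suc k) = recF zeroF (eqᶜ k ∘ᶜ projF (# 0))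

eqᶜ-correct : ∀ k x → ⟦ eqᶜ k ⟧₁ x ≡ bit (x ≡ᵇ k)
eqᶜ-correct zero zero = refl
eqᶜ-correct zero (suc x) = refl
eqᶜ-correct (suc k) zero = refl
eqᶜ-correct (suc k) (suc x) = eqᶜ-correct k x

anyBelow : (ℕ → Bool) → ℕ → Bool
anyBelow p zero = false
anyBelow p (suc n) = p n ∨ anyBelow p n

anyBelow-intro : ∀ {p} d k → p k ≡ true → anyBelow p (d + suc k) ≡ true
anyBelow-intro {p} zero k pk = cong (_∨ anyBelow p k) pk
anyBelow-intro {p} (suc d) k pk =
  trans (cong (p (d + suc k) ∨_) (anyBelow-intro d k pk)) (∨-zeroʳ (p (d + suc k)))

anyBelow-elim : ∀ {p} n → anyBelow p n ≡ true → Σ[ k ∈ ℕ ] p k ≡ true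
anyBelow-elim {p} (suc n) hit with p n in pn
... | true = n , pn
... | false = anyBelow-elim n hit

anyBelowᶜ : PR 2 → PR 2
anyBelowᶜ p = recF zeroF (compF p (projF (# 2) ∷ projF (# 0) ∷ []) ∨ᶜ projF (# 1))

anyBelowᶜ-correct : ∀ {p} (P : ℕ → ℕ → Bool) → (∀ y x → ⟦ p ⟧ (y ∷ x ∷ []) ≡ bit (P y x))
  → ∀ n y → ⟦ anyBelowᶜ p ⟧ (n ∷ y ∷ []) ≡ bit (anyBelow (P y) n)
anyBelowᶜ-correct P pP zero y = refl
anyBelowᶜ-correct P pP (suc n) y =
  orᶜ-bit (P y n) (anyBelow (P y) n) (pP y n) (anyBelowᶜ-correct P pP n y)

doubleᶜ : PR 1
doubleᶜ = recF zeroF (succF ∘ᶜ succF ∘ᶜ projF (# 1))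

-- Defined through doubleᶜ, so that codes built from doubleᶜ produce encoded states on the nose.
encode : ℕ ⊎ ℕ → ℕ
encode (inj₁ x) = ⟦ doubleᶜ ⟧₁ x
encode (inj₂ y) = suc (⟦ doubleᶜ ⟧₁ y)

decode-encode : ∀ z → decode (encode z) ≡ z
decode-encode (inj₁ zero) = refl
decode-encode (inj₁ (suc x)) = cong (map suc suc) (decode-encode (inj₁ x))
decode-encode (inj₂ zero) = refl
decode-encode (inj₂ (suc y)) = cong (map suc suc) (decode-encode (inj₂ y))

-- decode enumerates ℕ ⊎ ℕ as inj₁ 0, inj₂ 0, inj₁ 1, inj₂ 1, …
next : ℕ ⊎ ℕ → ℕ ⊎ ℕ
next (inj₁ x) = inj₂ x
next (inj₂ y) = inj₁ (suc y)

decode-suc : ∀ c → decode (suc c) ≡ next (decode c)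
decode-suc zero = refl
decode-suc (suc zero) = refl
decode-suc (suc (suc c)) = trans (cong (map suc suc) (decode-suc c)) (map-next (decode c))
  where
  map-next : ∀ z → map suc suc (next z) ≡ next (map suc suc z)
  map-next (inj₁ x) = refl
  map-next (inj₂ y) = refl

encode-next : ∀ z → encode (next z) ≡ suc (encode z)
encode-next (inj₁ x) = refl
encode-next (inj₂ y) = refl

encode-decode : ∀ c → encode (decode c) ≡ c
encode-decode zero = refl
encode-decode (suc c) = begin
  encode (decode (suc c))  ≡⟨ cong encode (decode-suc c) ⟩
  encode (next (decode c)) ≡⟨ encode-next (decode c) ⟩
  suc (encode (decode c))  ≡⟨ cong suc (encode-decode c) ⟩
  suc c                    ∎

halted : ℕ ⊎ ℕ → Bool
halted (inj₁ _) = false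
halted (inj₂ _) = true

halted⇒inj₂ : ∀ z → halted z ≡ true → z ≡ inj₂ (reduce z)
halted⇒inj₂ (inj₂ y) _ = refl

haltedᶜ : PR 1
haltedᶜ = recF zeroF (notᶜ ∘ᶜ projF (# 1))

haltedᶜ-correct : ∀ c → ⟦ haltedᶜ ⟧₁ c ≡ bit (halted (decode c))
haltedᶜ-correct zero = refl
haltedᶜ-correct (suc c) = begin
  ⟦ haltedᶜ ⟧₁ (suc c)                ≡⟨ notᶜ-bit _ (haltedᶜ-correct c) ⟩
  bit (not (halted (decode c)))       ≡⟨ cong bit (not-halted (decode c)) ⟩
  bit (halted (next (decode c)))      ≡⟨ cong (bit ∘ halted) (sym (decode-suc c)) ⟩
  bit (halted (decode (suc c)))       ∎
  where
  not-halted : ∀ z → not (halted z) ≡ halted (next z)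
  not-halted (inj₁ x) = refl
  not-halted (inj₂ y) = refl

reduceᶜ : PR 1
reduceᶜ = recF zeroF (ifᶜ (haltedᶜ ∘ᶜ projF (# 0)) (succF ∘ᶜ projF (# 1)) (projF (# 1)))

reduceᶜ-correct : ∀ c → ⟦ reduceᶜ ⟧₁ c ≡ reduce (decode c)
reduceᶜ-correct zero = refl
reduceᶜ-correct (suc c) = begin
  ⟦ reduceᶜ ⟧₁ (suc c)
    ≡⟨ condᶜ-bit (halted (decode c)) (haltedᶜ-correct c) ⟩
  (if halted (decode c) then suc (⟦ reduceᶜ ⟧₁ c) else ⟦ reduceᶜ ⟧₁ c)
    ≡⟨ cong (λ r → if halted (decode c) then suc r else r) (reduceᶜ-correct c) ⟩
  (if halted (decode c) then suc (reduce (decode c)) else reduce (decode c))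
    ≡⟨ reduce-next (decode c) ⟩
  reduce (next (decode c))
    ≡⟨ cong reduce (sym (decode-suc c)) ⟩
  reduce (decode (suc c))
    ∎
  where
  reduce-next : ∀ z → (if halted z then suc (reduce z) else reduce z) ≡ reduce (next z)
  reduce-next (inj₁ x) = refl
  reduce-next (inj₂ y) = refl

stepᶜ : PR 1 → PR 1
stepᶜ s = ifᶜ haltedᶜ (projF (# 0)) (s ∘ᶜ reduceᶜ)

stepᶜ-correct : ∀ i s c → decode (⟦ stepᶜ s ⟧₁ c) ≡ step (i , s) (decode c)
stepᶜ-correct i s c = begin
  decode (⟦ stepᶜ s ⟧₁ c)
    ≡⟨ cong decode (condᶜ-bit (halted (decode c)) (haltedᶜ-correct c)) ⟩
  decode (if halted (decode c) then c else ⟦ s ⟧₁ (⟦ reduceᶜ ⟧₁ c))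
    ≡⟨ cong (λ r → decode (if halted (decode c) then c else ⟦ s ⟧₁ r)) (reduceᶜ-correct c) ⟩
  decode (if halted (decode c) then c else ⟦ s ⟧₁ (reduce (decode c)))
    ≡⟨ simulate (decode c) refl ⟩
  step (i , s) (decode c)
    ∎
  where
  simulate : ∀ z → decode c ≡ z
    → decode (if halted z then c else ⟦ s ⟧₁ (reduce z)) ≡ step (i , s) z
  simulate (inj₁ x) _ = refl
  simulate (inj₂ y) eq = eq

run-suc : ∀ m k x → run (suc k) m x ≡ step m (run k m x)
run-suc m k x = trans (cong (λ j → run j m x) (+-comm 1 k)) (iter-+ m k 1 _)

runᶜ : Machine → PR 2
runᶜ (i , s) = recF (doubleᶜ ∘ᶜ i) (stepᶜ s ∘ᶜ projF (# 1))

runᶜ-correct : ∀ m k x → decode (⟦ runᶜ m ⟧ (k ∷ x ∷ [])) ≡ run k m x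
runᶜ-correct m zero x = decode-encode (inj₁ _)
runᶜ-correct (i , s) (suc k) x = begin
  decode (⟦ stepᶜ s ⟧₁ state)    ≡⟨ stepᶜ-correct i s state ⟩
  step (i , s) (decode state)    ≡⟨ cong (step (i , s)) (runᶜ-correct (i , s) k x) ⟩
  step (i , s) (run k (i , s) x) ≡⟨ sym (run-suc (i , s) k x) ⟩
  run (suc k) (i , s) x          ∎
  where
  state : ℕ
  state = ⟦ runᶜ (i , s) ⟧ (k ∷ x ∷ [])

haltedᶜ-run : ∀ m k x → ⟦ haltedᶜ ⟧₁ (⟦ runᶜ m ⟧ (k ∷ x ∷ [])) ≡ bit (halted (run k m x))
haltedᶜ-run m k x =
  trans (haltedᶜ-correct (⟦ runᶜ m ⟧ (k ∷ x ∷ []))) (cong (bit ∘ halted) (runᶜ-correct m k x))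

returns? : ℕ → Machine → ℕ → ℕ → Bool
returns? y m k x = ⟦ runᶜ m ⟧ (k ∷ x ∷ []) ≡ᵇ encode (inj₂ y)

returns?⇒run : ∀ y m k x → returns? y m k x ≡ true → run k m x ≡ inj₂ y
returns?⇒run y m k x hit = begin
  run k m x                ≡⟨ sym (runᶜ-correct m k x) ⟩
  decode state             ≡⟨ cong decode (≡ᵇ⇒≡ state (encode (inj₂ y)) (Equivalence.from T-≡ hit)) ⟩
  decode (encode (inj₂ y)) ≡⟨ decode-encode (inj₂ y) ⟩
  inj₂ y                   ∎
  where
  state : ℕ
  state = ⟦ runᶜ m ⟧ (k ∷ x ∷ [])

run⇒returns? : ∀ y m k x → run k m x ≡ inj₂ y → returns? y m k x ≡ true
run⇒returns? y m k x r = Equivalence.to T-≡ (≡⇒≡ᵇ state (encode (inj₂ y)) (begin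
  state                 ≡⟨ sym (encode-decode state) ⟩
  encode (decode state) ≡⟨ cong encode (trans (runᶜ-correct m k x) r) ⟩
  encode (inj₂ y)       ∎))
  where
  state : ℕ
  state = ⟦ runᶜ m ⟧ (k ∷ x ∷ [])

run-mono : ∀ {m x k k' y} → k ≤ k' → run k m x ≡ inj₂ y → run k' m x ≡ inj₂ y
run-mono {m} {x} {k} {k'} {y} k≤k' r = subst (λ j → run j m x ≡ inj₂ y) (m+[n∸m]≡n k≤k') (begin
  iter m (k + (k' ∸ k)) _     ≡⟨ iter-+ m k (k' ∸ k) _ ⟩
  iter m (k' ∸ k) (run k m x) ≡⟨ cong (iter m (k' ∸ k)) r ⟩
  iter m (k' ∸ k) (inj₂ y)    ≡⟨ iter-inj₂ m (k' ∸ k) y ⟩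
  inj₂ y                      ∎)

haltsAt : Machine → ℕ → ℕ → Bool
haltsAt m x n = not (halted (run n m x)) ∧ halted (run (suc n) m x)

not∧-true : ∀ a b → not a ∧ b ≡ true → a ≡ false × b ≡ true
not∧-true false true _ = refl , refl

halted-mono : ∀ {m x k k'} → k ≤ k' → halted (run k m x) ≡ true → halted (run k' m x) ≡ true
halted-mono k≤k' h = cong halted (run-mono k≤k' (halted⇒inj₂ _ h))

haltsAt-≮ : ∀ {m x n n'} → n < n' → haltsAt m x n ≡ true → haltsAt m x n' ≡ true → ⊥
haltsAt-≮ n<n' h h'
  with trans (sym (proj₁ (not∧-true _ _ h'))) (halted-mono n<n' (proj₂ (not∧-true _ _ h)))
... | ()

haltsAt-unique : ∀ {m x n n'} → haltsAt m x n ≡ true → haltsAt m x n' ≡ true → n ≡ n'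
haltsAt-unique {n = n} {n'} h h' with <-cmp n n'
... | tri< n<n' _ _ = ⊥-elim (haltsAt-≮ n<n' h h')
... | tri≈ _ n≡n' _ = n≡n'
... | tri> _ _ n'<n = ⊥-elim (haltsAt-≮ n'<n h' h)

first-haltsAt : ∀ {m x} k → halted (run k m x) ≡ true → Σ[ n ∈ ℕ ] haltsAt m x n ≡ true
first-haltsAt zero ()
first-haltsAt {m} {x} (suc k) h with halted (run k m x) in eq
... | true = first-haltsAt k eq
... | false = k , trans (cong (λ b → not b ∧ halted (run (suc k) m x)) eq) h

haltsAtᶜ : Machine → ℕ → PR 1
haltsAtᶜ m x =
  (notᶜ ∘ᶜ haltedᶜ ∘ᶜ runAt (projF (# 0))) ∧ᶜ (haltedᶜ ∘ᶜ runAt (succF ∘ᶜ projF (# 0)))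
  where
  runAt : PR 1 → PR 1
  runAt k = compF (runᶜ m) (k ∷ constᶜ x ∷ [])

haltsAtᶜ-correct : ∀ m x n → ⟦ haltsAtᶜ m x ⟧₁ n ≡ bit (haltsAt m x n)
haltsAtᶜ-correct m x n =
  andᶜ-bit _ (halted (run (suc n) m x)) (notᶜ-bit (halted (run n m x)) (haltedAt n)) (haltedAt (suc n))
  where
  haltedAt : ∀ k → ⟦ haltedᶜ ⟧₁ (⟦ runᶜ m ⟧ (k ∷ ⟦ constᶜ x ⟧₁ n ∷ [])) ≡ bit (halted (run k m x))
  haltedAt k rewrite constᶜ-correct x (n ∷ []) = haltedᶜ-run m k x

search : PR 1 → Machine
search q = zeroF , ifᶜ q (constᶜ 1) (doubleᶜ ∘ᶜ succF)

module Search {q : PR 1} (Q : ℕ → Bool) (q-correct : ∀ c → ⟦ q ⟧₁ c ≡ bit (Q c)) where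

  search-step : ∀ c → step (search q) (inj₁ c) ≡ (if Q c then inj₂ 0 else inj₁ (suc c))
  search-step c = trans (cong decode (condᶜ-bit (Q c) (q-correct c))) (decode-if (Q c))
    where
    decode-if : ∀ b
      → decode (if b then 1 else encode (inj₁ (suc c))) ≡ (if b then inj₂ 0 else inj₁ (suc c))
    decode-if true = refl
    decode-if false = decode-encode (inj₁ (suc c))

  search-hit : ∀ {c} → Q c ≡ true → step (search q) (inj₁ c) ≡ inj₂ 0
  search-hit {c} hit = trans (search-step c) (cong (λ b → if b then inj₂ 0 else inj₁ (suc c)) hit)

  search-miss : ∀ {c} → Q c ≡ false → step (search q) (inj₁ c) ≡ inj₁ (suc c)
  search-miss {c} miss = trans (search-step c) (cong (λ b → if b then inj₂ 0 else inj₁ (suc c)) miss)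

  search-from : ∀ d c → Q (d + c) ≡ true → Σ[ j ∈ ℕ ] iter (search q) j (inj₁ c) ≡ inj₂ 0
  search-from zero c hit = 1 , search-hit hit
  search-from (suc d) c hit with Q c in eq
  ... | true = 1 , search-hit eq
  ... | false =
    let j , r = search-from d (suc c) (subst (λ c' → Q c' ≡ true) (sym (+-suc d c)) hit)
    in suc j , trans (cong (iter (search q) j) (search-miss eq)) r

  search-found : ∀ {y} j c → iter (search q) j (inj₁ c) ≡ inj₂ y → Σ[ c' ∈ ℕ ] Q c' ≡ true
  search-found zero c ()
  search-found (suc j) c r with Q c in eq
  ... | true = c , eq
  ... | false = search-found j (suc c) (trans (cong (iter (search q) j) (sym (search-miss eq))) r)

seekᶜ : Machine → PR 1
seekᶜ m = compF (anyBelowᶜ (eqᶜ (encode (inj₂ 1)) ∘ᶜ runᶜ m)) (projF (# 0) ∷ projF (# 0) ∷ [])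

seek : Machine → ℕ → Bool
seek m c = anyBelow (returns? 1 m c) c

seeker : Machine → Machine
seeker m = search (seekᶜ m)

seekᶜ-correct : ∀ m c → ⟦ seekᶜ m ⟧₁ c ≡ bit (seek m c)
seekᶜ-correct m c =
  anyBelowᶜ-correct (returns? 1 m)
    (λ k x → eqᶜ-correct (encode (inj₂ 1)) (⟦ runᶜ m ⟧ (k ∷ x ∷ []))) c c

seek-intro : ∀ m k n → run k m n ≡ inj₂ 1 → seek m (k + suc n) ≡ true
seek-intro m k n r =
  anyBelow-intro k n (run⇒returns? 1 m (k + suc n) n (run-mono (m≤m+n k (suc n)) r))

seek-elim : ∀ m c → seek m c ≡ true → Σ[ n ∈ ℕ ] run c m n ≡ inj₂ 1
seek-elim m c hit = let n , r = anyBelow-elim c hit in n , returns?⇒run 1 m c n r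

answer : PR 1 → Machine
answer f = projF (# 0) , succF ∘ᶜ doubleᶜ ∘ᶜ f

answer-run : ∀ f x → run 1 (answer f) x ≡ inj₂ (⟦ f ⟧₁ x)
answer-run f x = decode-encode (inj₂ (⟦ f ⟧₁ x))

⇔⇒≃ : ∀ {a b} {X : Set a} {Y : Set b} → isProp X → isProp Y → (X → Y) → (Y → X) → X ≃ Y
⇔⇒≃ pX pY f g = ↔⇒≃ (mk↔ₛ′ f g (λ y → pY _ _) (λ x → pX _ _))

isProp⇒UIP : ∀ {a} {P : Set a} → isProp P → {x y : P} (p q : x ≡ y) → p ≡ q
isProp⇒UIP pP = Constant⇒UIP.≡-irrelevant (λ {x} {y} _ → pP x y) (λ _ _ → refl)

module Semidecidability (fe : ∀ {a b} → Extensionality a b) (pe : PropExt 0ℓ) (pt : PropTrunc) where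
  open WithTrunc pt

  𝟚→ℕ≡bit : ∀ b → 𝟚→ℕ b ≡ bit b
  𝟚→ℕ≡bit false = refl
  𝟚→ℕ≡bit true = refl

  isProp-isProp : {P : Set} → isProp (isProp P)
  isProp-isProp p q = fe λ x → fe λ y → isProp⇒UIP p (p x y) (q x y)

  𝓛-≡ : ∀ {Y} (l l' : 𝓛 Y) → (defined l → defined l') → (defined l' → defined l)
    → (∀ d d' → value l d ≡ value l' d') → l ≡ l'
  𝓛-≡ (P , pP , v) (Q , pQ , w) f g v≡w = go (pe pP pQ f g) pQ w v≡w
    where
    go : P ≡ Q → ∀ pQ w → (∀ d d' → v d ≡ w d') → (P , pP , v) ≡ (Q , pQ , w)
    go refl pQ w v≡w = cong₂ (λ p u → P , p , u) (isProp-isProp pP pQ) (fe λ d → v≡w d d)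

  η≡eval⇒run : ∀ {v m x} → η v ≡ eval m x → ∥ Σ[ k ∈ ℕ ] run k m x ≡ inj₂ v ∥
  η≡eval⇒run {v} {m} {x} e =
    subst (λ l → (d : defined l) → ∥ Σ[ k ∈ ℕ ] run k m x ≡ inj₂ (value l d) ∥) (sym e) proj₂ tt

  η≡eval-answer : ∀ f x → η (⟦ f ⟧₁ x) ≡ eval (answer f) x
  η≡eval-answer f x = 𝓛-≡ (η (⟦ f ⟧₁ x)) (eval (answer f) x)
    (λ _ → ⟦ f ⟧₁ x , ∣ 1 , answer-run f x ∣)
    (λ _ → tt)
    (λ { tt (y , t) →
      ∥∥-rec ℕ-irrelevant (λ (k , r) → run-det (answer f) x 1 k _ y (answer-run f x) r) t })

  PR⇒isComputable𝟚 : ∀ (f : PR 1) (h : ℕ → 𝟚) → (∀ n → ⟦ f ⟧₁ n ≡ bit (h n)) → isComputable𝟚 h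
  PR⇒isComputable𝟚 f h f≡h = ∣ answer f , fe (λ n → trans (cong η (h≡f n)) (η≡eval-answer f n)) ∣
    where
    h≡f : ∀ n → 𝟚→ℕ (h n) ≡ ⟦ f ⟧₁ n
    h≡f n = trans (𝟚→ℕ≡bit (h n)) (sym (f≡h n))

  ⟨⟩-isProp : ∀ {h : ℕ → 𝟚} → (∀ {n n'} → h n ≡ true → h n' ≡ true → n ≡ n') → isProp ⟨ h ⟩
  ⟨⟩-isProp {h} unique (n , p) (n' , p') = go (unique p p') p'
    where
    go : n ≡ n' → (p' : h n' ≡ true) → (n , p) ≡ (n' , p')
    go refl p' = cong (n ,_) (Decidable⇒UIP.≡-irrelevant _≟_ p p')

  Halts-semiDecision : ∀ m x → SemiDecision (Halts m x)
  Halts-semiDecision m x =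
    haltsAt m x , haltsAt-isProp ,
    PR⇒isComputable𝟚 (haltsAtᶜ m x) (haltsAt m x) (haltsAtᶜ-correct m x) ,
    ⇔⇒≃ (Halts-isProp m x) haltsAt-isProp to from
    where
    haltsAt-isProp : isProp ⟨ haltsAt m x ⟩
    haltsAt-isProp = ⟨⟩-isProp haltsAt-unique
    to : Halts m x → ⟨ haltsAt m x ⟩
    to (y , t) = ∥∥-rec haltsAt-isProp (λ (k , r) → first-haltsAt k (cong halted r)) t
    from : ⟨ haltsAt m x ⟩ → Halts m x
    from (n , h) = reduce (run (suc n) m x) , ∣ suc n , halted⇒inj₂ _ (proj₂ (not∧-true _ _ h)) ∣

  module _ {q : PR 1} (Q : ℕ → Bool) (q-correct : ∀ c → ⟦ q ⟧₁ c ≡ bit (Q c)) where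
    open Search {q} Q q-correct

    search-halts : ∀ c → Q c ≡ true → Halts (search q) 0
    search-halts c hit =
      let j , r = search-from c 0 (subst (λ c' → Q c' ≡ true) (sym (+-identityʳ c)) hit)
      in 0 , ∣ j , r ∣

    halts-search : Halts (search q) 0 → ∥ Σ[ c ∈ ℕ ] Q c ≡ true ∥
    halts-search (y , t) = ∥∥-rec ∥∥-isProp (λ (j , r) → ∣ search-found j 0 r ∣) t

  𝟚→ℕ≡1 : ∀ b → 𝟚→ℕ b ≡ 1 → b ≡ true
  𝟚→ℕ≡1 false ()
  𝟚→ℕ≡1 true _ = refl

  ≡Halts-seeker : ∀ {A h m} → isProp A → (A → ⟨ h ⟩) → (⟨ h ⟩ → A)
    → (λ n → η (𝟚→ℕ (h n))) ≡ eval m → A ≡ Halts (seeker m) 0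
  ≡Halts-seeker {A} {h} {m} A-isProp to from h≡m =
    pe A-isProp (Halts-isProp _ 0) (root⇒Halts ∘ to) Halts⇒A
    where
    runs-to-h : ∀ n → ∥ Σ[ k ∈ ℕ ] run k m n ≡ inj₂ (𝟚→ℕ (h n)) ∥
    runs-to-h n = η≡eval⇒run (cong (λ f → f n) h≡m)

    root⇒Halts : ⟨ h ⟩ → Halts (seeker m) 0
    root⇒Halts (n , hn) = ∥∥-rec (Halts-isProp _ 0) found (runs-to-h n)
      where
      found : Σ[ k ∈ ℕ ] run k m n ≡ inj₂ (𝟚→ℕ (h n)) → Halts (seeker m) 0
      found (k , r) = search-halts (seek m) (seekᶜ-correct m) (k + suc n)
        (seek-intro m k n (trans r (cong (inj₂ ∘ 𝟚→ℕ) hn)))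

    Halts⇒A : Halts (seeker m) 0 → A
    Halts⇒A halts = ∥∥-rec A-isProp found (halts-search (seek m) (seekᶜ-correct m) halts)
      where
      found : Σ[ c ∈ ℕ ] seek m c ≡ true → A
      found (c , hit) = let n , r = seek-elim m c hit in
        ∥∥-rec A-isProp (λ (k , r') → from (n , 𝟚→ℕ≡1 (h n) (run-det m n k c _ 1 r' r)))
          (runs-to-h n)

  SemiDecision⇒halting : ∀ {A} → SemiDecision A
    → ∃[ f ∈ (ℕ → 𝓛 ℕ) ] (isComputable f × (A ≡ defined (f 0)))
  SemiDecision⇒halting {A} (h , h-isProp , h-computable , A≃h) = ∥∥-rec ∥∥-isProp
    (λ (m , h≡m) → ∣ eval (seeker m) , ∣ seeker m , refl ∣ ,
                     ≡Halts-seeker A-isProp (_≃_.to A≃h) (_≃_.from A≃h) h≡m ∣)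
    h-computable
    where
    A-isProp : isProp A
    A-isProp x y = _≃_.injective A≃h (h-isProp _ _)

  halting⇒isSemiDecidable : ∀ {A} → ∃[ f ∈ (ℕ → 𝓛 ℕ) ] (isComputable f × (A ≡ defined (f 0)))
    → isSemiDecidable A
  halting⇒isSemiDecidable {A} = ∥∥-rec ∥∥-isProp λ (f , f-computable , A≡f0) →
    ∥∥-rec ∥∥-isProp (λ (m , f≡m) → ∣ subst SemiDecision (A≡Halts A≡f0 f≡m) (Halts-semiDecision m 0) ∣)
      f-computable
    where
    A≡Halts : ∀ {f m} → A ≡ defined (f 0) → f ≡ eval m → Halts m 0 ≡ A
    A≡Halts A≡f0 f≡m = sym (trans A≡f0 (cong (λ g → defined (g 0)) f≡m))

theorem8p22 : (fe : ∀ {a b} → Extensionality a b) (pe : PropExt 0ℓ) (pt : PropTrunc)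
    → let open WithTrunc pt in
      (A : Set)
    → isSemiDecidable A ≃ (∃[ f ∈ (ℕ → 𝓛 ℕ) ] (isComputable f × (A ≡ defined (f 0))))
theorem8p22 fe pe pt A =
  ⇔⇒≃ ∥∥-isProp ∥∥-isProp (∥∥-rec ∥∥-isProp SemiDecision⇒halting) halting⇒isSemiDecidable
  where
  open WithTrunc pt
  open Semidecidability fe pe pt
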